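{- Let $G_x,G_y$ be graphs (possibly with loops) on a common vertex set $S$, each with minimum degree at least $1$. Then there exists a set $D\subseteq S$ which is dominated in both $G_x$ and $G_y$ with $|D|\ge |S|/3$. Moreover, if $|S|=3$, then one can find such a set with $|D|=2$ unless the union of the non-loop edges of $G_x$ and $G_y$ forms a triangle $K_3$ on $S$.
   Context: Graphs may have loops; the degree of a vertex is the number of edges incident to it, loops counted with multiplicity. In such a graph $G$, a set $D\subseteq V(G)$ is dominated if every $v\in D$ either has a loop or has a neighbor outside $D$. -}

module Defs where

open import Data.Nat using (ℕ)
open import Data.Bool using (Bool; true; false)
open import Data.Fin using (Fin)
open import Data.Fin.Subset using (Subset; _∈_; _∉_)
open import Data.Product using (Σ; ∃; _×_)
open import Data.Sum using (_⊎_)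
open import Relation.Binary.PropositionalEquality using (_≡_; _≢_)

-- A graph (possibly with loops) on the vertex set Fin n, given by its
-- symmetric adjacency relation; adj v v ≡ true means v carries a loop.
-- Edge multiplicities play no role in the statement (only adjacency and
-- "degree ≥ 1" matter), so we do not record them.
record Graph (n : ℕ) : Set where
  field
    adj  : Fin n → Fin n → Bool
    sym  : ∀ u v → adj u v ≡ adj v u
open Graph public

MinDegreeAtLeast1 : ∀ {n} → Graph n → Set
MinDegreeAtLeast1 {n} G = ∀ (v : Fin n) → ∃ λ u → adj G v u ≡ true

Dominated : ∀ {n} → Graph n → Subset n → Set
Dominated {n} G D =
  ∀ (v : Fin n) → v ∈ D →
    adj G v v ≡ true ⊎ (∃ λ u → u ∉ D × adj G v u ≡ true)

UnionNonLoopComplete : ∀ {n} → Graph n → Graph n → Set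
UnionNonLoopComplete {n} Gx Gy =
  ∀ (u v : Fin n) → u ≢ v → adj Gx u v ≡ true ⊎ adj Gy u v ≡ true

-- Each graph of minimum degree at least 1 has a spanning star forest in which every centre
-- carries a loop or at least one leaf.  A colour class is dominated as soon as every leaf
-- gets a colour different from its centre, and the star forests of Gx and Gy admit one
-- common 3-colouring with this property; its largest class has at least |S|/3 vertices.
-- For |S| = 3, two vertices adjacent in neither graph form a set dominated in both, since
-- each of them has a loop or a neighbour outside the pair.
module Submission where

open import Defs renaming (sym to adj-sym)
open import Data.Nat using (ℕ; zero; suc; _+_; _*_; _≤_; _⊔_)
open import Data.Nat.Properties
  using (+-suc; +-assoc; +-identityʳ; +-mono-≤; ≤-trans; m≤m⊔n; m≤n⊔m; ⊔-sel)
open import Data.Fin using (Fin; zero; suc; #_)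
open import Data.Fin.Properties using (_≟_; any?; all?; ¬∀⟶∃¬)
open import Data.Fin.Subset using (Subset; ∣_∣; _∈_; _∉_; ⁅_⁆; _∪_)
open import Data.Fin.Subset.Properties
  using (_∈?_; x∈p∪q⁻; x∈⁅y⁆⇒x≡y; ∣⁅x⁆∣≡1; ∪-identityˡ; ∪-identityʳ)
open import Data.Bool using (Bool; true; false)
import Data.Bool.Properties as Bool
open import Data.Maybe using (Maybe; nothing; just; is-nothing; fromMaybe)
open import Data.Maybe.Properties as Maybe using (just-injective)
open import Data.Product using (Σ; ∃; ∃₂; _×_; _,_; proj₁; proj₂)
open import Data.Sum using (_⊎_; inj₁; inj₂)
open import Data.Unit using (⊤; tt)
open import Data.Vec using (tabulate)
open import Data.Vec.Properties using (lookup∘tabulate; []=⇒lookup)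
open import Data.Vec.Functional using (updateAt)
open import Data.Vec.Functional.Properties using (updateAt-updates; updateAt-minimal)
open import Data.List using (List; []; _∷_; allFin)
open import Data.List.Relation.Unary.All as All using (All; []; _∷_)
open import Data.List.Membership.Propositional.Properties using (∈-allFin)
open import Function using (_∘_; id; const)
open import Relation.Nullary using (¬_; Dec; yes; no; does; ¬?; contradiction)
open import Relation.Nullary.Decidable using (_⊎-dec_; _→-dec_)
open import Relation.Unary using (_⊆_)
open import Relation.Binary.PropositionalEquality

edge-sym : ∀ {n} (G : Graph n) {u v} → adj G u v ≡ true → adj G v u ≡ true
edge-sym G {u} {v} uv = trans (adj-sym G v u) uv

module _ {S : Set} {n : ℕ} (P : S → Fin n → Set)
         (improve : ∀ s x → Σ S λ s′ → P s′ x × P s ⊆ P s′) where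

  improve-list : (xs : List (Fin n)) (s : S) → Σ S λ s′ → P s ⊆ P s′ × All (P s′) xs
  improve-list []       s = s , id , []
  improve-list (x ∷ xs) s with improve s x
  ... | s₁ , px , s⊆s₁ with improve-list xs s₁
  ...   | s₂ , s₁⊆s₂ , all = s₂ , s₁⊆s₂ ∘ s⊆s₁ , s₁⊆s₂ px ∷ all

  improve-everywhere : S → Σ S λ s → ∀ x → P s x
  improve-everywhere s₀ with improve-list (allFin n) s₀
  ... | s , _ , all = s , λ x → All.lookup all (∈-allFin x)

three-times : ∀ m → m + m + m ≡ 3 * m
three-times m = trans (+-assoc m m m) (cong (λ k → m + (m + k)) (sym (+-identityʳ m)))

sum≤3*max : ∀ a b c → a + b + c ≤ 3 * (a ⊔ b ⊔ c)
sum≤3*max a b c = subst (a + b + c ≤_) (three-times (a ⊔ b ⊔ c))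
  (+-mono-≤ (+-mono-≤ (≤-trans (m≤m⊔n a b) (m≤m⊔n (a ⊔ b) c))
                      (≤-trans (m≤n⊔m a b) (m≤m⊔n (a ⊔ b) c)))
            (m≤n⊔m (a ⊔ b) c))

pigeonhole₃ : ∀ a b c {n} → a + b + c ≡ n → n ≤ 3 * a ⊎ n ≤ 3 * b ⊎ n ≤ 3 * c
pigeonhole₃ a b c refl = select (⊔-sel (a ⊔ b) c) (⊔-sel a b)
  where
  bound : ∀ {m} → a ⊔ b ⊔ c ≡ m → a + b + c ≤ 3 * m
  bound max≡m = subst (λ m → a + b + c ≤ 3 * m) max≡m (sum≤3*max a b c)
  select : a ⊔ b ⊔ c ≡ a ⊔ b ⊎ a ⊔ b ⊔ c ≡ c → a ⊔ b ≡ a ⊎ a ⊔ b ≡ b →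
           a + b + c ≤ 3 * a ⊎ a + b + c ≤ 3 * b ⊎ a + b + c ≤ 3 * c
  select (inj₂ max≡c)  _           = inj₂ (inj₂ (bound max≡c))
  select (inj₁ max≡ab) (inj₁ ab≡a) = inj₁ (bound (trans max≡ab ab≡a))
  select (inj₁ max≡ab) (inj₂ ab≡b) = inj₂ (inj₁ (bound (trans max≡ab ab≡b)))

colourClass : ∀ {n} → (Fin n → Fin 3) → Fin 3 → Subset n
colourClass col k = tabulate (λ v → does (col v ≟ k))

∈-colourClass : ∀ {n} (col : Fin n → Fin 3) k {v} → v ∈ colourClass col k → col v ≡ k
∈-colourClass col k {v} v∈
  with col v ≟ k | trans (sym (lookup∘tabulate _ v)) ([]=⇒lookup v∈)
... | yes colour≡k | _ = colour≡k
... | no _         | ()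

+-suc-middle : ∀ a b c → a + suc b + c ≡ suc (a + b + c)
+-suc-middle a b c = cong (_+ c) (+-suc a b)

+-suc-last : ∀ a b c → a + b + suc c ≡ suc (a + b + c)
+-suc-last a b c = +-suc (a + b) c

colourClasses-cover : ∀ {n} (col : Fin n → Fin 3) →
  ∣ colourClass col (# 0) ∣ + ∣ colourClass col (# 1) ∣ + ∣ colourClass col (# 2) ∣ ≡ n
colourClasses-cover {zero}  col = refl
colourClasses-cover {suc n} col with col zero | colourClasses-cover (col ∘ suc)
... | zero           | cover = cong suc cover
... | suc zero       | cover =
  trans (+-suc-middle (size (# 0)) (size (# 1)) (size (# 2))) (cong suc cover)
  where size = λ k → ∣ colourClass (col ∘ suc) k ∣
... | suc (suc zero) | cover =
  trans (+-suc-last (size (# 0)) (size (# 1)) (size (# 2))) (cong suc cover)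
  where size = λ k → ∣ colourClass (col ∘ suc) k ∣

largeColourClass : ∀ {n} (col : Fin n → Fin 3) → ∃ λ k → n ≤ 3 * ∣ colourClass col k ∣
largeColourClass col
  with pigeonhole₃ (size (# 0)) (size (# 1)) (size (# 2)) (colourClasses-cover col)
  where size = λ k → ∣ colourClass col k ∣
... | inj₁ large        = # 0 , large
... | inj₂ (inj₁ large) = # 1 , large
... | inj₂ (inj₂ large) = # 2 , large

Role : ℕ → Set
Role n = Maybe (Fin n)

pattern centre   = nothing
pattern leafOf c = just c

centre≢leafOf : ∀ {n} {c : Fin n} → centre ≢ leafOf c
centre≢leafOf ()

module _ {n : ℕ} (G : Graph n) where

  record StarForest : Set where
    field
      role      : Fin n → Role n
      leaf-edge : ∀ {v c} → role v ≡ leafOf c → role c ≡ centre × adj G v c ≡ true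
  open StarForest public

  Supported : StarForest → Fin n → Set
  Supported F c = adj G c c ≡ true ⊎ ∃ λ w → role F w ≡ leafOf c

  Settled : StarForest → Fin n → Set
  Settled F c = role F c ≡ centre → Supported F c

  Leafless : StarForest → Fin n → Set
  Leafless F v = ∀ w → role F w ≢ leafOf v

  AgreeOff : Fin n → StarForest → StarForest → Set
  AgreeOff v F F′ = ∀ {w} → w ≢ v → role F′ w ≡ role F w

  supported? : ∀ F c → Dec (Supported F c)
  supported? F c = (adj G c c Bool.≟ true) ⊎-dec any? (λ w → Maybe.≡-dec _≟_ (role F w) (leafOf c))

  allCentres : StarForest
  allCentres = record { role = const centre ; leaf-edge = λ () }

  leaf-settled : ∀ F {v c} → role F v ≡ leafOf c → Settled F v
  leaf-settled F v↦c v-centre with () ← trans (sym v↦c) v-centre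

  settled-off : ∀ F F′ {v d} → AgreeOff v F F′ → d ≢ v → role F v ≢ leafOf d →
                Settled F d → Settled F′ d
  settled-off F F′ {v} {d} agree d≢v v↛d settled d-centre
    with settled (trans (sym (agree d≢v)) d-centre)
  ... | inj₁ loop       = inj₁ loop
  ... | inj₂ (w , w↦d) = inj₂ (w , trans (agree w≢v) w↦d)
    where
    w≢v : w ≢ v
    w≢v refl = v↛d w↦d

  Admissible : StarForest → Fin n → Role n → Set
  Admissible F v centre     = ⊤
  Admissible F v (leafOf c) = v ≢ c × Leafless F v × role F c ≡ centre × adj G v c ≡ true

  admissible-target : ∀ {F v x} r → Admissible F v r → role F x ≡ leafOf v → r ≡ centre
  admissible-target centre     _                  _   = refl
  admissible-target (leafOf _) (_ , leafless , _) x↦v with () ← leafless _ x↦v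

  admissible-leaf : ∀ {F v c} r → Admissible F v r → r ≡ leafOf c →
                    v ≢ c × role F c ≡ centre × adj G v c ≡ true
  admissible-leaf (leafOf _) (v≢c , _ , c-centre , vc) refl = v≢c , c-centre , vc

  reassign : ∀ F v r → Admissible F v r → Σ StarForest λ F′ → role F′ v ≡ r × AgreeOff v F F′
  reassign F v r admissible = record { role = role′ ; leaf-edge = edge } , moved , kept
    where
    role′ : Fin n → Role n
    role′ = updateAt (role F) v (const r)
    moved : role′ v ≡ r
    moved = updateAt-updates v (role F)
    kept : ∀ {w} → w ≢ v → role′ w ≡ role F w
    kept w≢v = updateAt-minimal _ v (role F) w≢v
    target-centre : ∀ {x d} → role F x ≡ leafOf d → role′ d ≡ centre
    target-centre {x} {d} x↦d with d ≟ v
    ... | yes refl = trans moved (admissible-target r admissible x↦d)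
    ... | no d≢v   = trans (kept d≢v) (proj₁ (leaf-edge F x↦d))
    edge : ∀ {x d} → role′ x ≡ leafOf d → role′ d ≡ centre × adj G x d ≡ true
    edge {x} x↦d with x ≟ v
    ... | yes refl = let v≢d , d-centre , vd = admissible-leaf r admissible (trans (sym moved) x↦d)
                     in trans (kept (v≢d ∘ sym)) d-centre , vd
    ... | no x≢v   = let x↦d₀ = trans (sym (kept x≢v)) x↦d
                     in target-centre x↦d₀ , proj₂ (leaf-edge F x↦d₀)

  Improvement : StarForest → Fin n → Set
  Improvement F c = Σ StarForest λ F′ → Settled F′ c × Settled F ⊆ Settled F′

  improve-unsupported : ∀ F c → (role F c ≡ centre → ¬ Supported F c → Improvement F c) →
                        Improvement F c
  improve-unsupported F c fix with role F c in c-role | supported? F c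
  ... | leafOf _ | _       = F , leaf-settled F c-role , id
  ... | centre   | yes sup = F , const sup , id
  ... | centre   | no ¬sup = fix refl ¬sup

  attach-unsupported : ∀ {F c u} → role F c ≡ centre → ¬ Supported F c →
                       role F u ≡ centre → adj G c u ≡ true →
                       Σ StarForest λ F′ → role F′ c ≡ leafOf u × Settled F ⊆ Settled F′
  attach-unsupported {F} {c} {u} c-centre ¬sup u-centre cu
    with reassign F c (leafOf u) (c≢u , (λ w w↦c → ¬sup (inj₂ (w , w↦c))) , u-centre , cu)
    where
    c≢u : c ≢ u
    c≢u refl = ¬sup (inj₁ cu)
  ... | F′ , c↦u , agree = F′ , c↦u , preserved
    where
    preserved : Settled F ⊆ Settled F′
    preserved {d} settled with d ≟ c
    ... | yes refl = leaf-settled F′ c↦u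
    ... | no d≢c   =
      settled-off F F′ agree d≢c (λ c↦d → centre≢leafOf (trans (sym c-centre) c↦d)) settled

  unsupported-off : ∀ F F′ {u c} → AgreeOff u F F′ → role F′ u ≡ centre →
                    ¬ Supported F c → ¬ Supported F′ c
  unsupported-off F F′ {u} agree u-centre ¬sup (inj₁ loop) = ¬sup (inj₁ loop)
  unsupported-off F F′ {u} agree u-centre ¬sup (inj₂ (w , w↦c)) with w ≟ u
  ... | yes refl = centre≢leafOf (trans (sym u-centre) w↦c)
  ... | no w≢u   = ¬sup (inj₂ (w , trans (sym (agree w≢u)) w↦c))

  settle-beside-centre : ∀ F c {u} → role F u ≡ centre → adj G c u ≡ true → Improvement F c
  settle-beside-centre F c u-centre cu = improve-unsupported F c λ c-centre ¬sup →
    let F′ , c↦u , preserved = attach-unsupported {F} c-centre ¬sup u-centre cu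
    in F′ , leaf-settled F′ c↦u , preserved

  -- u becomes a centre with leaf c; its old centre c′ may thereby lose its only leaf, in
  -- which case c′ is attached to u as well.
  settle-via-leaf : ∀ F {c u c′} → role F c ≡ centre → ¬ Supported F c →
                    role F u ≡ leafOf c′ → adj G c u ≡ true → Improvement F c
  settle-via-leaf F {c} {u} {c′} c-centre ¬sup u↦c′ cu with reassign F u centre tt
  ... | F₁ , u-centre₁ , agree₁
    with attach-unsupported {F₁} (trans (agree₁ c≢u) c-centre)
                            (unsupported-off F F₁ agree₁ u-centre₁ ¬sup) u-centre₁ cu
    where
    c≢u : c ≢ u
    c≢u refl = centre≢leafOf (trans (sym c-centre) u↦c′)
  ...   | F₂ , c↦u₂ , F₁⊆F₂
    with settle-beside-centre F₂ c′ (proj₁ (leaf-edge F₂ c↦u₂))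
                              (edge-sym G (proj₂ (leaf-edge F u↦c′)))
  ...     | F₃ , c′-settled , F₂⊆F₃ = F₃ , F₂⊆F₃ (leaf-settled F₂ c↦u₂) , preserved
    where
    preserved : Settled F ⊆ Settled F₃
    preserved {d} settled with d ≟ c′ | d ≟ u
    ... | yes refl | _        = c′-settled
    ... | no _     | yes refl = F₂⊆F₃ (λ _ → inj₂ (c , c↦u₂))
    ... | no d≢c′  | no d≢u   =
      let u↛d = d≢c′ ∘ sym ∘ just-injective ∘ trans (sym u↦c′)
      in F₂⊆F₃ (F₁⊆F₂ (settled-off F F₁ agree₁ d≢u u↛d settled))

  settle-unsupported : ∀ F {c u} → role F c ≡ centre → ¬ Supported F c →
                       adj G c u ≡ true → Improvement F c
  settle-unsupported F {c} {u} c-centre ¬sup cu with role F u in u-role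
  ... | centre   = settle-beside-centre F c u-role cu
  ... | leafOf _ = settle-via-leaf F c-centre ¬sup u-role cu

  spanningStarForest : MinDegreeAtLeast1 G → Σ StarForest λ F → ∀ c → Settled F c
  spanningStarForest δ = improve-everywhere Settled settle allCentres
    where
    settle : ∀ F c → Improvement F c
    settle F c = improve-unsupported F c λ c-centre ¬sup →
      settle-unsupported F c-centre ¬sup (proj₂ (δ c))

  Separates : StarForest → (Fin n → Fin 3) → Set
  Separates F col = ∀ {v c} → role F v ≡ leafOf c → col v ≢ col c

  separates-classes : ∀ F {col} → Separates F col → ∀ k {x y} → role F x ≡ leafOf y →
                      x ∈ colourClass col k → y ∉ colourClass col k
  separates-classes F {col} separates k x↦y x∈ y∈ =
    separates x↦y (trans (∈-colourClass col k x∈) (sym (∈-colourClass col k y∈)))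

  colourClass-dominated : ∀ F {col} → (∀ c → Settled F c) → Separates F col →
                          ∀ k → Dominated G (colourClass col k)
  colourClass-dominated F {col} settled separates k v v∈ with role F v in v-role
  ... | leafOf c =
    inj₂ (c , separates-classes F separates k v-role v∈ , proj₂ (leaf-edge F v-role))
  ... | centre with settled v v-role
  ...   | inj₁ loop        = inj₁ loop
  ...   | inj₂ (w , w↦v) =
    inj₂ (w , (λ w∈ → separates-classes F separates k w↦v w∈ v∈) , edge-sym G (proj₂ (leaf-edge F w↦v)))

-- x-centres get colours 0 and 1, y-centres 0 and 2 (0 when both); a vertex that is a leaf
-- in both forests then has a colour avoiding those of its two centres.
mixColour : Bool → Bool → Bool → Bool → Fin 3
mixColour true  true  _     _     = # 0
mixColour true  false _     _     = # 1
mixColour false true  _     _     = # 2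
mixColour false false true  _     = # 1
mixColour false false false true  = # 2
mixColour false false false false = # 0

mixColour-separates-x : ∀ b e f g h → mixColour false b e f ≢ mixColour true e g h
mixColour-separates-x true  true  _     _ _ ()
mixColour-separates-x true  false _     _ _ ()
mixColour-separates-x false true  _     _ _ ()
mixColour-separates-x false false true  _ _ ()
mixColour-separates-x false false false false _ ()

mixColour-separates-y : ∀ a e f g h → mixColour a false e f ≢ mixColour f true g h
mixColour-separates-y true  _     true  _ _ ()
mixColour-separates-y true  _     false _ _ ()
mixColour-separates-y false true  true  _ _ ()
mixColour-separates-y false true  false _ _ ()
mixColour-separates-y false false true  _ _ ()
mixColour-separates-y false false false _ _ ()

isCentre : ∀ {n} {G : Graph n} → StarForest G → Fin n → Bool
isCentre F v = is-nothing (role F v)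

starCentre : ∀ {n} {G : Graph n} → StarForest G → Fin n → Fin n
starCentre F v = fromMaybe v (role F v)

module _ {n : ℕ} {Gx Gy : Graph n} (X : StarForest Gx) (Y : StarForest Gy) where

  jointColour : Fin n → Fin 3
  jointColour v = mixColour (isCentre X v) (isCentre Y v)
                            (isCentre Y (starCentre X v)) (isCentre X (starCentre Y v))

  jointColour-separates-x : Separates Gx X jointColour
  jointColour-separates-x {v} {c} v↦c with leaf-edge X v↦c
  ... | c-centre , _ rewrite v↦c | c-centre =
    mixColour-separates-x (isCentre Y v) (isCentre Y c) (isCentre X (starCentre Y v))
                          (isCentre Y c) (isCentre X (starCentre Y c))

  jointColour-separates-y : Separates Gy Y jointColour
  jointColour-separates-y {v} {c} v↦c with leaf-edge Y v↦c
  ... | c-centre , _ rewrite v↦c | c-centre =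
    mixColour-separates-y (isCentre X v) (isCentre Y (starCentre X v)) (isCentre X c)
                          (isCentre Y (starCentre X c)) (isCentre X c)

∈-pair : ∀ {n} {u v x : Fin n} → x ∈ ⁅ u ⁆ ∪ ⁅ v ⁆ → x ≡ u ⊎ x ≡ v
∈-pair {u = u} {v} x∈ with x∈p∪q⁻ ⁅ u ⁆ ⁅ v ⁆ x∈
... | inj₁ x∈u = inj₁ (x∈⁅y⁆⇒x≡y u x∈u)
... | inj₂ x∈v = inj₂ (x∈⁅y⁆⇒x≡y v x∈v)

∣⁅x⁆∪⁅y⁆∣≡2 : ∀ {n} {x y : Fin n} → x ≢ y → ∣ ⁅ x ⁆ ∪ ⁅ y ⁆ ∣ ≡ 2
∣⁅x⁆∪⁅y⁆∣≡2 {x = zero}  {zero}  x≢y = contradiction refl x≢y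
∣⁅x⁆∪⁅y⁆∣≡2 {x = zero}  {suc y} _   = cong suc (trans (cong ∣_∣ (∪-identityˡ ⁅ y ⁆)) (∣⁅x⁆∣≡1 y))
∣⁅x⁆∪⁅y⁆∣≡2 {x = suc x} {zero}  _   = cong suc (trans (cong ∣_∣ (∪-identityʳ ⁅ x ⁆)) (∣⁅x⁆∣≡1 x))
∣⁅x⁆∪⁅y⁆∣≡2 {x = suc x} {suc y} x≢y = ∣⁅x⁆∪⁅y⁆∣≡2 (x≢y ∘ cong suc)

non-edge-dominated : ∀ {n} (G : Graph n) {u v} → MinDegreeAtLeast1 G → adj G u v ≡ false →
                     Dominated G (⁅ u ⁆ ∪ ⁅ v ⁆)
non-edge-dominated G {u} {v} δ ¬uv x x∈ with δ x
... | t , xt with t ∈? (⁅ u ⁆ ∪ ⁅ v ⁆)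
...   | no t∉  = inj₂ (t , t∉ , xt)
...   | yes t∈ =
  inj₁ (subst (λ y → adj G x y ≡ true) (sym (inner-edge-is-loop (∈-pair x∈) (∈-pair t∈) xt)) xt)
  where
  inner-edge-is-loop : ∀ {x t} → x ≡ u ⊎ x ≡ v → t ≡ u ⊎ t ≡ v → adj G x t ≡ true → x ≡ t
  inner-edge-is-loop (inj₁ refl) (inj₁ refl) _  = refl
  inner-edge-is-loop (inj₂ refl) (inj₂ refl) _  = refl
  inner-edge-is-loop (inj₁ refl) (inj₂ refl) uv = contradiction (trans (sym uv) ¬uv) λ ()
  inner-edge-is-loop (inj₂ refl) (inj₁ refl) vu = contradiction (trans (sym (edge-sym G vu)) ¬uv) λ ()

missing-edge : ∀ {n} (Gx Gy : Graph n) → ¬ UnionNonLoopComplete Gx Gy →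
               ∃₂ λ u v → u ≢ v × adj Gx u v ≡ false × adj Gy u v ≡ false
missing-edge {n} Gx Gy ¬complete =
  let u , ¬all     = ¬∀⟶∃¬ n _ (λ u → all? (covered? u)) ¬complete
      v , ¬covered = ¬∀⟶∃¬ n _ (covered? u) ¬all
  in u , v , (λ u≡v → ¬covered (contradiction u≡v))
   , Bool.¬-not (¬covered ∘ const ∘ inj₁) , Bool.¬-not (¬covered ∘ const ∘ inj₂)
  where
  covered? : ∀ u v → Dec (u ≢ v → adj Gx u v ≡ true ⊎ adj Gy u v ≡ true)
  covered? u v = ¬? (u ≟ v) →-dec ((adj Gx u v Bool.≟ true) ⊎-dec (adj Gy u v Bool.≟ true))

lemma4p4 : ((n : ℕ) (Gx Gy : Graph n) → MinDegreeAtLeast1 Gx → MinDegreeAtLeast1 Gy →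
      ∃ λ (D : Subset n) → Dominated Gx D × Dominated Gy D × n ≤ 3 * ∣ D ∣)
    × ((Gx Gy : Graph 3) → MinDegreeAtLeast1 Gx → MinDegreeAtLeast1 Gy →
      ¬ UnionNonLoopComplete Gx Gy →
      ∃ λ (D : Subset 3) → Dominated Gx D × Dominated Gy D × ∣ D ∣ ≡ 2)
lemma4p4 = third , pair
  where
  third : (n : ℕ) (Gx Gy : Graph n) → MinDegreeAtLeast1 Gx → MinDegreeAtLeast1 Gy →
          ∃ λ (D : Subset n) → Dominated Gx D × Dominated Gy D × n ≤ 3 * ∣ D ∣
  third n Gx Gy δx δy =
    let X , X-settled = spanningStarForest Gx δx
        Y , Y-settled = spanningStarForest Gy δy
        k , large     = largeColourClass (jointColour X Y)
    in colourClass (jointColour X Y) k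
     , colourClass-dominated Gx X X-settled (jointColour-separates-x X Y) k
     , colourClass-dominated Gy Y Y-settled (jointColour-separates-y X Y) k
     , large
  pair : (Gx Gy : Graph 3) → MinDegreeAtLeast1 Gx → MinDegreeAtLeast1 Gy →
         ¬ UnionNonLoopComplete Gx Gy →
         ∃ λ (D : Subset 3) → Dominated Gx D × Dominated Gy D × ∣ D ∣ ≡ 2
  pair Gx Gy δx δy ¬complete =
    let u , v , u≢v , ¬uvx , ¬uvy = missing-edge Gx Gy ¬complete
    in ⁅ u ⁆ ∪ ⁅ v ⁆ , non-edge-dominated Gx δx ¬uvx , non-edge-dominated Gy δy ¬uvy
     , ∣⁅x⁆∪⁅y⁆∣≡2 u≢v
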